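{- Let $m\ge 1$ and let $X$ be a family of subsets of $[2m]=\{1,\dots,2m\}$. Then the number of colourings $c:[2m]\to\{0,1\}$ with $|c^{ -1}(0)|=m$ for which some $x\in X$ is homogeneous for $c$ is at most $2|\nabla_m(X)|$, where $\nabla_m(X)=\{y\subseteq[2m]:|y|=m,\ x\subseteq y\text{ for some }x\in X\}$.
   Context: A set $x$ is homogeneous for a colouring $c$ if $c$ is constant on $x$. -}

module Defs where

open import Data.Nat using (ℕ; zero; suc; _*_)
open import Data.Bool using (Bool; true; false)
open import Data.Bool.Properties renaming (_≟_ to _≟ᵇ_)
open import Data.Fin using (Fin)
open import Data.Fin.Properties using (all?)
open import Data.Fin.Subset using (Subset; _⊆_; _∈_; ∣_∣)
open import Data.Fin.Subset.Properties using (_⊆?_; _∈?_)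
open import Data.Vec using (Vec; []; _∷_; lookup; count)
open import Data.List using (List; []; _∷_; _++_; map; length; filter)
open import Data.List.Relation.Unary.Any using (Any; any?)
open import Data.Product using (Σ; ∃; _×_; _,_)
open import Relation.Binary.PropositionalEquality using (_≡_)
open import Relation.Nullary using (Dec; yes; no; ¬_)
open import Relation.Nullary.Decidable using (_⊎-dec_; _→-dec_; _×-dec_)
import Data.Nat.Properties as ℕP

-- The ground set [n] is Fin n; subsets of [n] are Subset n = Vec Bool n.
-- A colouring c : [n] → {0,1} is represented as Vec Bool n,
-- colour 0 ↔ false, colour 1 ↔ true;  c i = lookup c i.
Colouring : ℕ → Set
Colouring n = Vec Bool n

allVecs : (n : ℕ) → List (Vec Bool n)
allVecs zero = [] ∷ []
allVecs (suc n) = map (false ∷_) (allVecs n) ++ map (true ∷_) (allVecs n)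

Homogeneous : {n : ℕ} → Colouring n → Subset n → Set
Homogeneous c x = Σ Bool λ b → ∀ i → i ∈ x → lookup c i ≡ b

homogeneous? : {n : ℕ} (c : Colouring n) (x : Subset n) → Dec (Homogeneous c x)
homogeneous? c x with all? (λ i → (i ∈? x) →-dec (lookup c i ≟ᵇ false))
                    | all? (λ i → (i ∈? x) →-dec (lookup c i ≟ᵇ true))
... | yes p | _ = yes (false , p)
... | no _ | yes q = yes (true , q)
... | no ¬p | no ¬q = no λ { (false , p) → ¬p p ; (true , q) → ¬q q }

zeros : {n : ℕ} → Colouring n → ℕ
zeros c = count (_≟ᵇ false) c

Good : {n : ℕ} → ℕ → List (Subset n) → Colouring n → Set
Good m X c = (zeros c ≡ m) × Any (Homogeneous c) X

good? : {n : ℕ} (m : ℕ) (X : List (Subset n)) (c : Colouring n) → Dec (Good m X c)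
good? m X c = (zeros c ℕP.≟ m) ×-dec any? (homogeneous? c) X

numGood : (n m : ℕ) → List (Subset n) → ℕ
numGood n m X = length (filter (good? m X) (allVecs n))

InShadow : {n : ℕ} → ℕ → List (Subset n) → Subset n → Set
InShadow m X y = (∣ y ∣ ≡ m) × Any (_⊆ y) X

inShadow? : {n : ℕ} (m : ℕ) (X : List (Subset n)) (y : Subset n) → Dec (InShadow m X y)
inShadow? m X y = (∣ y ∣ ℕP.≟ m) ×-dec any? (_⊆? y) X

-- |∇_m(X)|, subsets enumerated without repetition
upShadowSize : (n m : ℕ) → List (Subset n) → ℕ
upShadowSize n m X = length (filter (inShadow? m X) (allVecs n))

module Submission where

open import Defs
open import Data.Nat using (ℕ; zero; suc; _*_; _+_; _∸_; _≤_; _≥_; z≤n; s≤s)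
open import Data.Nat.Properties
  using (≤-refl; ≤-trans; n≤1+n; +-mono-≤; +-monoˡ-≤; +-monoʳ-≤; +-suc; +-comm;
         +-identityʳ; m+n∸m≡n; m∸[m∸n]≡n; module ≤-Reasoning)
open import Data.Bool using (Bool; true; false; not)
open import Data.Vec using (Vec; []; _∷_)
open import Data.Vec.Properties using (lookup-map; lookup⇒[]=)
open import Data.Fin.Subset using (Subset; _⊆_; ∁; ∣_∣)
open import Data.Fin.Subset.Properties using (∣∁p∣≡n∸∣p∣; ∣p∣≤n)
open import Data.List using (List; []; _∷_; _++_; map; length; filter)
open import Data.List.Properties using (filter-++; length-++; filter-accept)
import Data.List.Relation.Unary.Any as Any
open import Data.List.Relation.Unary.Any.Properties using (Any-⊎⁻)
open import Data.Product using (_,_)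
open import Data.Sum using (_⊎_; inj₁; inj₂)
open import Function using (_∘_)
open import Level using (0ℓ)
open import Relation.Binary.PropositionalEquality
open import Relation.Nullary using (does; yes; no)
open import Relation.Unary using (Pred; Decidable)

-- A good colouring c is constant on some x ∈ X.  Read c as the subset of its
-- 1-points: if the constant colour is 1 then x ⊆ c and |c| = 2m − m = m, so
-- c ∈ ∇ₘ(X); if it is 0 then ∁ c ∈ ∇ₘ(X).  So the good colourings number at
-- most |∇ₘ(X)| + |{c : ∁ c ∈ ∇ₘ(X)}|, and complementation permutes the
-- colourings, so both terms equal |∇ₘ(X)|.

count : {A : Set} {P : Pred A 0ℓ} → Decidable P → List A → ℕ
count P? xs = length (filter P? xs)

module _ {A : Set} {P : Pred A 0ℓ} (P? : Decidable P) where

  count-++ : (xs ys : List A) → count P? (xs ++ ys) ≡ count P? xs + count P? ys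
  count-++ xs ys = trans (cong length (filter-++ P? xs ys)) (length-++ (filter P? xs))

  count-map : {B : Set} (f : B → A) (xs : List B) → count P? (map f xs) ≡ count (P? ∘ f) xs
  count-map f [] = refl
  count-map f (x ∷ xs) with does (P? (f x))
  ... | true  = cong suc (count-map f xs)
  ... | false = count-map f xs

  count-accept : {x : A} {xs : List A} → P x → count P? (x ∷ xs) ≡ suc (count P? xs)
  count-accept p = cong length (filter-accept P? p)

  count-≤-∷ : (x : A) (xs : List A) → count P? xs ≤ count P? (x ∷ xs)
  count-≤-∷ x xs with does (P? x)
  ... | true  = n≤1+n _
  ... | false = ≤-refl

count-≤-+ : {A : Set} {P Q R : Pred A 0ℓ}
            (P? : Decidable P) (Q? : Decidable Q) (R? : Decidable R) →
            (∀ {x} → P x → Q x ⊎ R x) →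
            (xs : List A) → count P? xs ≤ count Q? xs + count R? xs
count-≤-+ P? Q? R? P⊆Q∪R [] = z≤n
count-≤-+ P? Q? R? P⊆Q∪R (x ∷ xs) with P? x
... | no _ = ≤-trans ih (+-mono-≤ (count-≤-∷ Q? x xs) (count-≤-∷ R? x xs))
  where ih = count-≤-+ P? Q? R? P⊆Q∪R xs
... | yes p with P⊆Q∪R p
...   | inj₁ q = begin
  suc (count P? xs)                        ≤⟨ s≤s ih ⟩
  suc (count Q? xs + count R? xs)          ≤⟨ s≤s (+-monoʳ-≤ (count Q? xs) (count-≤-∷ R? x xs)) ⟩
  suc (count Q? xs) + count R? (x ∷ xs)    ≡⟨ cong (_+ count R? (x ∷ xs)) (count-accept Q? q) ⟨
  count Q? (x ∷ xs) + count R? (x ∷ xs)    ∎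
  where open ≤-Reasoning
        ih = count-≤-+ P? Q? R? P⊆Q∪R xs
...   | inj₂ r = begin
  suc (count P? xs)                        ≤⟨ s≤s ih ⟩
  suc (count Q? xs + count R? xs)          ≤⟨ s≤s (+-monoˡ-≤ (count R? xs) (count-≤-∷ Q? x xs)) ⟩
  suc (count Q? (x ∷ xs) + count R? xs)    ≡⟨ +-suc (count Q? (x ∷ xs)) (count R? xs) ⟨
  count Q? (x ∷ xs) + suc (count R? xs)    ≡⟨ cong (count Q? (x ∷ xs) +_) (count-accept R? r) ⟨
  count Q? (x ∷ xs) + count R? (x ∷ xs)    ∎
  where open ≤-Reasoning
        ih = count-≤-+ P? Q? R? P⊆Q∪R xs

count-allVecs-suc : ∀ n {Q : Pred (Vec Bool (suc n)) 0ℓ} (Q? : Decidable Q) →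
                    count Q? (allVecs (suc n)) ≡
                    count (Q? ∘ (false ∷_)) (allVecs n) + count (Q? ∘ (true ∷_)) (allVecs n)
count-allVecs-suc n Q? = trans (count-++ Q? (map (false ∷_) vs) (map (true ∷_) vs))
                               (cong₂ _+_ (count-map Q? (false ∷_) vs) (count-map Q? (true ∷_) vs))
  where vs = allVecs n

count-allVecs-∁ : ∀ n {Q : Pred (Subset n) 0ℓ} (Q? : Decidable Q) →
                  count (Q? ∘ ∁) (allVecs n) ≡ count Q? (allVecs n)
count-allVecs-∁ zero    Q? with does (Q? [])
... | true  = refl
... | false = refl
count-allVecs-∁ (suc n) Q? = begin
  count (Q? ∘ ∁) (allVecs (suc n))
    ≡⟨ count-allVecs-suc n (Q? ∘ ∁) ⟩
  count (Q? ∘ (true ∷_) ∘ ∁) vs + count (Q? ∘ (false ∷_) ∘ ∁) vs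
    ≡⟨ cong₂ _+_ (count-allVecs-∁ n (Q? ∘ (true ∷_))) (count-allVecs-∁ n (Q? ∘ (false ∷_))) ⟩
  count (Q? ∘ (true ∷_)) vs + count (Q? ∘ (false ∷_)) vs
    ≡⟨ +-comm (count (Q? ∘ (true ∷_)) vs) _ ⟩
  count (Q? ∘ (false ∷_)) vs + count (Q? ∘ (true ∷_)) vs
    ≡⟨ count-allVecs-suc n Q? ⟨
  count Q? (allVecs (suc n))
    ∎
  where open ≡-Reasoning
        vs = allVecs n

homogeneous⇒⊆⊎⊆∁ : ∀ {n} (c : Colouring n) {x : Subset n} → Homogeneous c x → x ⊆ c ⊎ x ⊆ ∁ c
homogeneous⇒⊆⊎⊆∁ c (true  , c≡1) = inj₁ λ {i} i∈x → lookup⇒[]= i c (c≡1 i i∈x)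
homogeneous⇒⊆⊎⊆∁ c (false , c≡0) = inj₂ λ {i} i∈x →
  lookup⇒[]= i (∁ c) (trans (lookup-map i not c) (cong not (c≡0 i i∈x)))

∣∁c∣≡zeros : ∀ {n} (c : Colouring n) → ∣ ∁ c ∣ ≡ zeros c
∣∁c∣≡zeros []          = refl
∣∁c∣≡zeros (true  ∷ c) = ∣∁c∣≡zeros c
∣∁c∣≡zeros (false ∷ c) = cong suc (∣∁c∣≡zeros c)

∣p∣≡n∸∣∁p∣ : ∀ {n} (p : Subset n) → ∣ p ∣ ≡ n ∸ ∣ ∁ p ∣
∣p∣≡n∸∣∁p∣ {n} p = trans (sym (m∸[m∸n]≡n (∣p∣≤n p))) (cong (n ∸_) (sym (∣∁p∣≡n∸∣p∣ p)))

2*m∸m≡m : ∀ m → 2 * m ∸ m ≡ m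
2*m∸m≡m m = trans (m+n∸m≡n m (m + 0)) (+-identityʳ m)

good⇒inShadow⊎inShadow∁ : ∀ m {X : List (Subset (2 * m))} (c : Colouring (2 * m)) →
                          Good m X c → InShadow m X c ⊎ InShadow m X (∁ c)
good⇒inShadow⊎inShadow∁ m c (zeros≡m , homogeneous)
  with Any-⊎⁻ (Any.map (homogeneous⇒⊆⊎⊆∁ c) homogeneous)
... | inj₁ ⊆c  = inj₁ (∣c∣≡m , ⊆c)
  where ∣c∣≡m : ∣ c ∣ ≡ m
        ∣c∣≡m = trans (∣p∣≡n∸∣∁p∣ c) (trans (cong (2 * m ∸_) (trans (∣∁c∣≡zeros c) zeros≡m)) (2*m∸m≡m m))
... | inj₂ ⊆∁c = inj₂ (trans (∣∁c∣≡zeros c) zeros≡m , ⊆∁c)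

lemma6p1 : (m : ℕ) → m ≥ 1 → (X : List (Subset (2 * m))) →
    numGood (2 * m) m X ≤ 2 * upShadowSize (2 * m) m X
lemma6p1 m _ X = begin
  numGood (2 * m) m X
    ≤⟨ count-≤-+ (good? m X) (inShadow? m X) (inShadow? m X ∘ ∁)
                 (good⇒inShadow⊎inShadow∁ m _) (allVecs (2 * m)) ⟩
  ∇ + count (inShadow? m X ∘ ∁) (allVecs (2 * m))
    ≡⟨ cong (∇ +_) (count-allVecs-∁ (2 * m) (inShadow? m X)) ⟩
  ∇ + ∇
    ≡⟨ cong (∇ +_) (+-identityʳ ∇) ⟨
  2 * ∇
    ∎
  where open ≤-Reasoning
        ∇ = upShadowSize (2 * m) m X
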